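{- Let $\mathbb A'$ and $\mathbb A''$ be two disjoint subalphabets of $\mathbb A$. For $m\ge1$ set $S^{\mathbb A'}_m(\mathbb A'')=S_{\{\{1\}\}}(\mathbb A')\mathbin{\sqcup\!\sqcup} S_{\{\{1,\dots,m-1\}\}}(\mathbb A'')$. Then for all $n,k\ge0$, $$\mathtt B_{n,k}\big(S^{\mathbb A'}_1(\mathbb A''),S^{\mathbb A'}_2(\mathbb A''),\dots,S^{\mathbb A'}_m(\mathbb A''),\dots\big)=S_{\{\{1\},\dots,\{k\}\}}(\mathbb A')\mathbin{\sqcup\!\sqcup} S_{\{\{1,\dots,n-k\}\}}(k\mathbb A'').$$
   Context: $\mathbb A$ is an infinite alphabet of noncommuting variables; $\mathbin{\sqcup\!\sqcup}$ is the shuffle product on $\mathbb C\langle\mathbb A\rangle$, and powers $F^{\mathbin{\sqcup\!\sqcup} k}$ are shuffle powers. For a subalphabet $\mathbb B\subseteq\mathbb A$ and a set partition $\pi=\{\pi_1,\dots,\pi_k\}$ of $\{1,\dots,n\}$: $\Phi_\pi(\mathbb B)=\sum\mathtt w$ over words $\mathtt w=\mathtt b_1\cdots\mathtt b_n$ over $\mathbb B$ with $\mathtt b_i=\mathtt b_j$ whenever $i,j$ lie in a common block; $\Psi_\pi(\mathbb B)=\#\pi_1!\cdots\#\pi_k!\,\Phi_\pi(\mathbb B)$; $S_\pi(\mathbb B)=\sum_{\pi'\le\pi}\Psi_{\pi'}(\mathbb B)$, where $\pi'\le\pi$ means $\pi'$ is finer than $\pi$. Conventions: $S_{\{\{1,\dots,0\}\}}(\mathbb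 B)=1$, $S_{\{\{1\},\dots,\{0\}\}}=1$, and $S_{\{\{1,\dots,j\}\}}=0$ for $j<0$. For an integer $k\ge0$, $S_{\{\{1,\dots,n\}\}}(k\mathbb B)$ is the coefficient of $t^n$ in $\big(\sum_{m\ge0}S_{\{\{1,\dots,m\}\}}(\mathbb B)t^m\big)^{\mathbin{\sqcup\!\sqcup} k}$. For $F_1,F_2,\dots\in\mathbb C\langle\mathbb A\rangle$, $\mathtt B_{n,k}(F_1,F_2,\dots)$ is defined by $\sum_{n\ge0}\mathtt B_{n,k}(F_1,F_2,\dots)t^n=\frac1{k!}\big(\sum_{i\ge1}F_it^i\big)^{\mathbin{\sqcup\!\sqcup} k}$. -}

module Defs where

open import Data.Bool using (Bool; true; false; _∧_; if_then_else_)
open import Data.Nat as ℕ using (ℕ; zero; suc; _∸_; _≡ᵇ_)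
open import Data.Nat.Properties using (_!≢0)
open import Data.Nat using (_!)
open import Data.Bool.ListAction using (and; all)
open import Data.Integer as ℤ using (ℤ; +_; -[1+_])
open import Data.List using (List; []; _∷_; _++_; map; concatMap; length; foldr; upTo)
open import Data.Maybe using (Maybe; just; nothing)
open import Data.Product using (_×_; _,_)
open import Data.Rational using (ℚ; 0ℚ; 1ℚ; _+_; _*_; _/_)

-- The infinite alphabet 𝔸 is taken to be ℕ (letters are naturals).
Letter : Set
Letter = ℕ

Word : Set
Word = List Letter

Subalphabet : Set
Subalphabet = Letter → Bool

-- Elements of ℂ⟨𝔸⟩ (possibly infinite formal sums of words, e.g. Φ_π(𝔹)
-- for infinite 𝔹), represented by their coefficient function.
-- All coefficients occurring are rational, so ℚ is used.
Series : Set
Series = Word → ℚ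

sumℚ : List ℚ → ℚ
sumℚ = foldr _+_ 0ℚ

zeroS : Series
zeroS _ = 0ℚ

oneS : Series
oneS [] = 1ℚ
oneS (_ ∷ _) = 0ℚ

_⊕_ : Series → Series → Series
(F ⊕ G) w = F w + G w

sumS : List Series → Series
sumS = foldr _⊕_ zeroS

scale : ℚ → Series → Series
scale q F w = q * F w

splits : Word → List (Word × Word)
splits [] = ([] , []) ∷ []
splits (x ∷ xs) =
  concatMap (λ { (u , v) → (x ∷ u , v) ∷ (u , x ∷ v) ∷ [] }) (splits xs)

_⧢_ : Series → Series → Series
(F ⧢ G) w = sumℚ (map (λ { (u , v) → F u * G v }) (splits w))

-- Set partitions (blocks are lists of positions 1..n)

Block : Set
Block = List ℕ

Partition : Set
Partition = List Block

insertEach : ℕ → Partition → List Partition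
insertEach x [] = []
insertEach x (b ∷ bs) = ((x ∷ b) ∷ bs) ∷ map (b ∷_) (insertEach x bs)

setParts : List ℕ → List Partition
setParts [] = [] ∷ []
setParts (x ∷ xs) =
  concatMap (λ p → ((x ∷ []) ∷ p) ∷ insertEach x p) (setParts xs)

refinements : Partition → List Partition
refinements [] = [] ∷ []
refinements (b ∷ bs) =
  concatMap (λ p → map (p ++_) (refinements bs)) (setParts b)

size : Partition → ℕ
size π = foldr (λ b n → length b ℕ.+ n) 0 π

-- i-th letter of a word, 1-based
at : Word → ℕ → Maybe Letter
at [] _ = nothing
at (a ∷ w) zero = nothing
at (a ∷ w) (suc zero) = just a
at (a ∷ w) (suc (suc i)) = at w (suc i)

eqM : Maybe Letter → Maybe Letter → Bool
eqM (just a) (just b) = a ≡ᵇ b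
eqM _ _ = false

blockConst : Word → Block → Bool
blockConst w [] = true
blockConst w (i ∷ is) = all (λ j → eqM (at w j) (at w i)) is

indicator : Bool → ℚ
indicator true = 1ℚ
indicator false = 0ℚ

-- Φ_π(𝔹): sum of the words b₁⋯bₙ over 𝔹 with bᵢ = bⱼ when i, j share a block
Φ : Partition → Subalphabet → Series
Φ π B w = indicator ((length w ≡ᵇ size π) ∧ all B w ∧ and (map (blockConst w) π))

Ψ : Partition → Subalphabet → Series
Ψ π B = scale ((+ foldr (λ b n → (length b !) ℕ.* n) 1 π) / 1) (Φ π B)

S : Partition → Subalphabet → Series
S π B = sumS (map (λ π' → Ψ π' B) (refinements π))

-- {{1,…,m}}  (for m = 0 this gives S = 1, matching the convention)
oneBlock : ℕ → Partition
oneBlock m = map suc (upTo m) ∷ []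

finest : ℕ → Partition
finest k = map (λ i → i ∷ []) (map suc (upTo k))

SOne : ℤ → Subalphabet → Series
SOne (+ m) B = S (oneBlock m) B
SOne -[1+ _ ] B = zeroS

TSeries : Set
TSeries = ℕ → Series

oneT : TSeries
oneT zero = oneS
oneT (suc _) = zeroS

_⧢ₜ_ : TSeries → TSeries → TSeries
(P ⧢ₜ Q) n = sumS (map (λ j → P j ⧢ Q (n ∸ j)) (upTo (suc n)))

_^⧢_ : TSeries → ℕ → TSeries
P ^⧢ zero = oneT
P ^⧢ suc k = P ⧢ₜ (P ^⧢ k)

-- S_{{1,…,j}}(k𝔹): coefficient of t^j in (Σ_m S_{{1..m}}(𝔹) t^m)^{⧢k}
-- (0 for j < 0)
SOneMul : ℕ → ℤ → Subalphabet → Series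
SOneMul k (+ n) B = ((λ m → SOne (+ m) B) ^⧢ k) n
SOneMul k -[1+ _ ] B = zeroS

-- B_{n,k}(F₁,F₂,…): coefficient of t^n in (1/k!) (Σ_{i≥1} Fᵢ tⁱ)^{⧢k}
-- (F 0 is ignored)
Bell : ℕ → ℕ → (ℕ → Series) → Series
Bell n k F = scale ((+ 1 / (k !)) {{k !≢0}}) (((λ i → pos i) ^⧢ k) n)
  where
  pos : ℕ → Series
  pos zero = zeroS
  pos (suc i) = F (suc i)

SSup : Subalphabet → Subalphabet → ℕ → Series
SSup A′ A″ m = SOne (+ 1) A′ ⧢ SOne (+ m ℤ.- + 1) A″

-- Put a = S_{{1}}(𝔸′) and F(t) = Σₘ S_{{1,…,m}}(𝔸″) tᵐ. Then Σ_{i≥1} S^{𝔸′}_i(𝔸″) tⁱ = t·(a ⧢ F(t)),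
-- and since ⧢ is commutative and associative its k-th shuffle power is tᵏ·(a^{⧢k} ⧢ F(t)^{⧢k}),
-- whose coefficient of tⁿ is a^{⧢k} ⧢ S_{{1,…,n−k}}(k𝔸″). Finally a is the sum of the one-letter
-- words over 𝔸′, so a^{⧢k} = k!·(sum of the words of length k over 𝔸′) = k!·S_{{1},…,{k}}(𝔸′).
-- The shuffle laws all follow by induction on words from the Leibniz rule
-- ∂ₓ(F ⧢ G) = ∂ₓF ⧢ G + F ⧢ ∂ₓG, where (∂ₓF)(w) = F(x w).
module Submission where

open import Defs
open import Data.Bool using (true; false; _∧_)
open import Data.Bool.Properties using (∧-identityʳ)
open import Data.Bool.ListAction using (and; all)
open import Data.Nat as ℕ using (ℕ; zero; suc; _∸_; _≡ᵇ_; _!; s≤s)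
open import Data.Nat.Properties using (_!≢0; n∸n≡0; +-∸-assoc)
import Data.Nat.Properties as ℕ
open import Data.Integer as ℤ using (ℤ; +_; -[1+_]; _-_)
import Data.Integer.Properties as ℤ
open import Data.List using (List; []; _∷_; map; concatMap; foldr; length; upTo; applyUpTo)
open import Data.List.Properties using (length-map; length-upTo)
open import Data.Product using (_×_; _,_; proj₁; proj₂)
open import Data.Rational using (ℚ; 0ℚ; 1ℚ; _+_; _*_; _/_; toℚᵘ)
open import Data.Rational.Properties
  using (+-identityˡ; +-identityʳ; +-assoc; +-comm; *-identityˡ; *-zeroˡ; *-zeroʳ; *-assoc; *-comm;
         *-distribˡ-+; toℚᵘ-injective; toℚᵘ-fromℚᵘ; toℚᵘ-homo-+; toℚᵘ-homo-*;
         +-0-commutativeMonoid; *-1-commutativeMonoid)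
import Data.Rational.Unnormalised as ℚᵘ
import Data.Rational.Unnormalised.Properties as ℚᵘ
open import Data.Rational.Solver using (module +-*-Solver)
open import Relation.Binary.PropositionalEquality
open import Algebra.Bundles using (CommutativeMonoid; CommutativeSemigroup)
open import Algebra.Structures using (IsCommutativeSemigroup)
open import Algebra.Properties.CommutativeSemigroup
  (CommutativeMonoid.commutativeSemigroup +-0-commutativeMonoid) using () renaming (interchange to +-interchange)
open import Algebra.Properties.CommutativeSemigroup
  (CommutativeMonoid.commutativeSemigroup *-1-commutativeMonoid) using () renaming (x∙yz≈y∙xz to x*yz≡y*xz)
open import Level using (0ℓ)
open import Relation.Binary.Bundles using (Setoid)
import Relation.Binary.Reasoning.Setoid as SetoidReasoning

fromℕ : ℕ → ℚ
fromℕ n = + n / 1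

toℚᵘ-fromℕ : ∀ n → toℚᵘ (fromℕ n) ℚᵘ.≃ ℚᵘ.mkℚᵘ (+ n) 0
toℚᵘ-fromℕ n = toℚᵘ-fromℚᵘ (ℚᵘ.mkℚᵘ (+ n) 0)

fromℕ-+ : ∀ m n → fromℕ (m ℕ.+ n) ≡ fromℕ m + fromℕ n
fromℕ-+ m n = toℚᵘ-injective (begin
  toℚᵘ (fromℕ (m ℕ.+ n))                 ≈⟨ toℚᵘ-fromℕ (m ℕ.+ n) ⟩
  ℚᵘ.mkℚᵘ (+ (m ℕ.+ n)) 0                ≈⟨ ℚᵘ.*≡* (cong (ℤ._* + 1) (trans (ℤ.pos-+ m n) (sym (cong₂ ℤ._+_ (ℤ.*-identityʳ (+ m)) (ℤ.*-identityʳ (+ n)))))) ⟩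
  ℚᵘ.mkℚᵘ (+ m) 0 ℚᵘ.+ ℚᵘ.mkℚᵘ (+ n) 0  ≈⟨ ℚᵘ.+-cong (toℚᵘ-fromℕ m) (toℚᵘ-fromℕ n) ⟨
  toℚᵘ (fromℕ m) ℚᵘ.+ toℚᵘ (fromℕ n)     ≈⟨ toℚᵘ-homo-+ (fromℕ m) (fromℕ n) ⟨
  toℚᵘ (fromℕ m + fromℕ n)               ∎)
  where open ℚᵘ.≃-Reasoning

fromℕ-* : ∀ m n → fromℕ (m ℕ.* n) ≡ fromℕ m * fromℕ n
fromℕ-* m n = toℚᵘ-injective (begin
  toℚᵘ (fromℕ (m ℕ.* n))                 ≈⟨ toℚᵘ-fromℕ (m ℕ.* n) ⟩
  ℚᵘ.mkℚᵘ (+ (m ℕ.* n)) 0                ≈⟨ ℚᵘ.*≡* (cong (ℤ._* + 1) (ℤ.pos-* m n)) ⟩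
  ℚᵘ.mkℚᵘ (+ m) 0 ℚᵘ.* ℚᵘ.mkℚᵘ (+ n) 0  ≈⟨ ℚᵘ.*-cong (toℚᵘ-fromℕ m) (toℚᵘ-fromℕ n) ⟨
  toℚᵘ (fromℕ m) ℚᵘ.* toℚᵘ (fromℕ n)     ≈⟨ toℚᵘ-homo-* (fromℕ m) (fromℕ n) ⟨
  toℚᵘ (fromℕ m * fromℕ n)               ∎)
  where open ℚᵘ.≃-Reasoning

1/n*n≡1 : ∀ n .{{_ : ℕ.NonZero n}} → (+ 1 / n) * fromℕ n ≡ 1ℚ
1/n*n≡1 n@(suc m) = toℚᵘ-injective (begin
  toℚᵘ ((+ 1 / n) * fromℕ n)                      ≈⟨ toℚᵘ-homo-* (+ 1 / n) (fromℕ n) ⟩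
  toℚᵘ (+ 1 / n) ℚᵘ.* toℚᵘ (fromℕ n)              ≈⟨ ℚᵘ.*-cong (toℚᵘ-fromℚᵘ (ℚᵘ.mkℚᵘ (+ 1) m)) (toℚᵘ-fromℕ n) ⟩
  ℚᵘ.1/ ℚᵘ.mkℚᵘ (+ n) 0 ℚᵘ.* ℚᵘ.mkℚᵘ (+ n) 0    ≈⟨ ℚᵘ.*-inverseˡ (ℚᵘ.mkℚᵘ (+ n) 0) ⟩
  ℚᵘ.1ℚᵘ                                         ∎)
  where open ℚᵘ.≃-Reasoning

infix 4 _≈_

_≈_ : Series → Series → Set
F ≈ G = ∀ w → F w ≡ G w

≈-setoid : Setoid 0ℓ 0ℓ
≈-setoid = record
  { Carrier = Series
  ; _≈_ = _≈_
  ; isEquivalence = record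
    { refl = λ _ → refl
    ; sym = λ F≈G w → sym (F≈G w)
    ; trans = λ F≈G G≈H w → trans (F≈G w) (G≈H w)
    }
  }

∂ : Letter → Series → Series
∂ x F w = F (x ∷ w)

⧢-[] : ∀ F G → (F ⧢ G) [] ≡ F [] * G []
⧢-[] F G = +-identityʳ (F [] * G [])

-- Each split of x ∷ w puts x at the front of either the left or the right subword.
⧢-∂ : ∀ x F G → ∂ x (F ⧢ G) ≈ (∂ x F ⧢ G) ⊕ (F ⧢ ∂ x G)
⧢-∂ x F G w = sum-splits-cons (splits w) (λ _ → refl)
  where
  open +-*-Solver
  f : Word × Word → ℚ
  f (u , v) = F u * G v
  sum-splits-cons : ∀ L {g : Word × Word → List (Word × Word)} →
    (∀ p → g p ≡ (x ∷ proj₁ p , proj₂ p) ∷ (proj₁ p , x ∷ proj₂ p) ∷ []) →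
    sumℚ (map f (concatMap g L)) ≡
      sumℚ (map (λ p → f (x ∷ proj₁ p , proj₂ p)) L) + sumℚ (map (λ p → f (proj₁ p , x ∷ proj₂ p)) L)
  sum-splits-cons [] _ = sym (+-identityʳ 0ℚ)
  sum-splits-cons ((u , v) ∷ L) {g} g≡ rewrite g≡ (u , v) =
    trans (cong (λ s → f (x ∷ u , v) + (f (u , x ∷ v) + s)) (sum-splits-cons L g≡))
      (solve 4 (λ a b c d → (a :+ (b :+ (c :+ d))) := (a :+ c) :+ (b :+ d)) refl
        (f (x ∷ u , v)) (f (u , x ∷ v)) _ _)

⧢-cong : ∀ {F F′ G G′} → F ≈ F′ → G ≈ G′ → F ⧢ G ≈ F′ ⧢ G′
⧢-cong {F} {F′} {G} {G′} F≈F′ G≈G′ [] =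
  trans (⧢-[] F G) (trans (cong₂ _*_ (F≈F′ []) (G≈G′ [])) (sym (⧢-[] F′ G′)))
⧢-cong {F} {F′} {G} {G′} F≈F′ G≈G′ (x ∷ w) =
  trans (⧢-∂ x F G w)
    (trans (cong₂ _+_ (⧢-cong (λ v → F≈F′ (x ∷ v)) G≈G′ w) (⧢-cong F≈F′ (λ v → G≈G′ (x ∷ v)) w))
      (sym (⧢-∂ x F′ G′ w)))

⧢-congˡ : ∀ F {G G′} → G ≈ G′ → F ⧢ G ≈ F ⧢ G′
⧢-congˡ F = ⧢-cong {F} (λ _ → refl)

⧢-congʳ : ∀ G {F F′} → F ≈ F′ → F ⧢ G ≈ F′ ⧢ G
⧢-congʳ G F≈F′ = ⧢-cong {G = G} F≈F′ (λ _ → refl)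

⧢-comm : ∀ F G → F ⧢ G ≈ G ⧢ F
⧢-comm F G [] = trans (⧢-[] F G) (trans (*-comm (F []) (G [])) (sym (⧢-[] G F)))
⧢-comm F G (x ∷ w) =
  trans (⧢-∂ x F G w)
    (trans (cong₂ _+_ (⧢-comm (∂ x F) G w) (⧢-comm F (∂ x G) w))
      (trans (+-comm ((G ⧢ ∂ x F) w) ((∂ x G ⧢ F) w)) (sym (⧢-∂ x G F w))))

⧢-zeroʳ : ∀ F → F ⧢ zeroS ≈ zeroS
⧢-zeroʳ F [] = trans (⧢-[] F zeroS) (*-zeroʳ (F []))
⧢-zeroʳ F (x ∷ w) =
  trans (⧢-∂ x F zeroS w) (trans (cong₂ _+_ (⧢-zeroʳ (∂ x F) w) (⧢-zeroʳ F w)) (+-identityʳ 0ℚ))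

⧢-zeroˡ : ∀ F → zeroS ⧢ F ≈ zeroS
⧢-zeroˡ F w = trans (⧢-comm zeroS F w) (⧢-zeroʳ F w)

⧢-identityˡ : ∀ F → oneS ⧢ F ≈ F
⧢-identityˡ F [] = trans (⧢-[] oneS F) (*-identityˡ (F []))
⧢-identityˡ F (x ∷ w) =
  trans (⧢-∂ x oneS F w)
    (trans (cong₂ _+_ (⧢-zeroˡ F w) (⧢-identityˡ (∂ x F) w)) (+-identityˡ (F (x ∷ w))))

⧢-distribˡ-⊕ : ∀ F G H → F ⧢ (G ⊕ H) ≈ (F ⧢ G) ⊕ (F ⧢ H)
⧢-distribˡ-⊕ F G H [] =
  trans (⧢-[] F (G ⊕ H)) (trans (*-distribˡ-+ (F []) (G []) (H [])) (sym (cong₂ _+_ (⧢-[] F G) (⧢-[] F H))))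
⧢-distribˡ-⊕ F G H (x ∷ w) =
  trans (⧢-∂ x F (G ⊕ H) w)
    (trans (cong₂ _+_ (⧢-distribˡ-⊕ (∂ x F) G H w) (⧢-distribˡ-⊕ F (∂ x G) (∂ x H) w))
      (trans (+-interchange ((∂ x F ⧢ G) w) ((∂ x F ⧢ H) w) ((F ⧢ ∂ x G) w) ((F ⧢ ∂ x H) w))
        (sym (cong₂ _+_ (⧢-∂ x F G w) (⧢-∂ x F H w)))))

⧢-distribʳ-⊕ : ∀ F G H → (G ⊕ H) ⧢ F ≈ (G ⧢ F) ⊕ (H ⧢ F)
⧢-distribʳ-⊕ F G H w =
  trans (⧢-comm (G ⊕ H) F w)
    (trans (⧢-distribˡ-⊕ F G H w) (cong₂ _+_ (⧢-comm F G w) (⧢-comm F H w)))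

⧢-scaleˡ : ∀ c F G → scale c F ⧢ G ≈ scale c (F ⧢ G)
⧢-scaleˡ c F G [] = trans (⧢-[] (scale c F) G) (trans (*-assoc c (F []) (G [])) (cong (c *_) (sym (⧢-[] F G))))
⧢-scaleˡ c F G (x ∷ w) =
  trans (⧢-∂ x (scale c F) G w)
    (trans (cong₂ _+_ (⧢-scaleˡ c (∂ x F) G w) (⧢-scaleˡ c F (∂ x G) w))
      (trans (sym (*-distribˡ-+ c _ _)) (cong (c *_) (sym (⧢-∂ x F G w)))))

⧢-scaleʳ : ∀ c F G → F ⧢ scale c G ≈ scale c (F ⧢ G)
⧢-scaleʳ c F G w =
  trans (⧢-comm F (scale c G) w) (trans (⧢-scaleˡ c G F w) (cong (c *_) (⧢-comm G F w)))

⧢-assoc : ∀ F G H → (F ⧢ G) ⧢ H ≈ F ⧢ (G ⧢ H)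
⧢-assoc F G H [] =
  trans (⧢-[] (F ⧢ G) H)
    (trans (cong (_* H []) (⧢-[] F G))
      (trans (*-assoc (F []) (G []) (H []))
        (sym (trans (⧢-[] F (G ⧢ H)) (cong (F [] *_) (⧢-[] G H))))))
⧢-assoc F G H (x ∷ w) = begin
  ((F ⧢ G) ⧢ H) (x ∷ w)
    ≡⟨ ⧢-∂ x (F ⧢ G) H w ⟩
  ((∂ x (F ⧢ G)) ⧢ H) w + ((F ⧢ G) ⧢ ∂ x H) w
    ≡⟨ cong (_+ ((F ⧢ G) ⧢ ∂ x H) w) (⧢-congʳ H (⧢-∂ x F G) w) ⟩
  (((∂ x F ⧢ G) ⊕ (F ⧢ ∂ x G)) ⧢ H) w + ((F ⧢ G) ⧢ ∂ x H) w
    ≡⟨ cong (_+ ((F ⧢ G) ⧢ ∂ x H) w) (⧢-distribʳ-⊕ H (∂ x F ⧢ G) (F ⧢ ∂ x G) w) ⟩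
  (((∂ x F ⧢ G) ⧢ H) w + ((F ⧢ ∂ x G) ⧢ H) w) + ((F ⧢ G) ⧢ ∂ x H) w
    ≡⟨ cong₂ _+_ (cong₂ _+_ (⧢-assoc (∂ x F) G H w) (⧢-assoc F (∂ x G) H w)) (⧢-assoc F G (∂ x H) w) ⟩
  ((∂ x F ⧢ (G ⧢ H)) w + (F ⧢ (∂ x G ⧢ H)) w) + (F ⧢ (G ⧢ ∂ x H)) w
    ≡⟨ +-assoc ((∂ x F ⧢ (G ⧢ H)) w) ((F ⧢ (∂ x G ⧢ H)) w) ((F ⧢ (G ⧢ ∂ x H)) w) ⟩
  (∂ x F ⧢ (G ⧢ H)) w + ((F ⧢ (∂ x G ⧢ H)) w + (F ⧢ (G ⧢ ∂ x H)) w)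
    ≡⟨ cong (_+_ ((∂ x F ⧢ (G ⧢ H)) w)) (sym (⧢-distribˡ-⊕ F (∂ x G ⧢ H) (G ⧢ ∂ x H) w)) ⟩
  (∂ x F ⧢ (G ⧢ H)) w + (F ⧢ ((∂ x G ⧢ H) ⊕ (G ⧢ ∂ x H))) w
    ≡⟨ cong (_+_ ((∂ x F ⧢ (G ⧢ H)) w)) (⧢-congˡ F (λ v → sym (⧢-∂ x G H v)) w) ⟩
  (∂ x F ⧢ (G ⧢ H)) w + (F ⧢ ∂ x (G ⧢ H)) w
    ≡⟨ ⧢-∂ x F (G ⧢ H) w ⟨
  (F ⧢ (G ⧢ H)) (x ∷ w) ∎
  where open ≡-Reasoning

⧢-isCommutativeSemigroup : IsCommutativeSemigroup _≈_ _⧢_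
⧢-isCommutativeSemigroup = record
  { isSemigroup = record
    { isMagma = record { isEquivalence = Setoid.isEquivalence ≈-setoid ; ∙-cong = ⧢-cong }
    ; assoc = ⧢-assoc
    }
  ; comm = ⧢-comm
  }

⧢-commutativeSemigroup : CommutativeSemigroup 0ℓ 0ℓ
⧢-commutativeSemigroup = record { isCommutativeSemigroup = ⧢-isCommutativeSemigroup }

open import Algebra.Properties.CommutativeSemigroup ⧢-commutativeSemigroup using () renaming (interchange to ⧢-interchange)

∑ : ℕ → (ℕ → Series) → Series
∑ zero f = zeroS
∑ (suc n) f = f 0 ⊕ ∑ n (λ j → f (suc j))

sumS-applyUpTo : ∀ n (f : ℕ → Series) g → sumS (map f (applyUpTo g n)) ≈ ∑ n (λ j → f (g j))
sumS-applyUpTo zero f g w = refl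
sumS-applyUpTo (suc n) f g w = cong (_+_ (f (g 0) w)) (sumS-applyUpTo n f (λ j → g (suc j)) w)

⧢ₜ-coeff : ∀ P Q n → (P ⧢ₜ Q) n ≈ ∑ (suc n) (λ j → P j ⧢ Q (n ∸ j))
⧢ₜ-coeff P Q n = sumS-applyUpTo (suc n) (λ j → P j ⧢ Q (n ∸ j)) (λ j → j)

∑-cong : ∀ n {f g : ℕ → Series} → (∀ j → j ℕ.< n → f j ≈ g j) → ∑ n f ≈ ∑ n g
∑-cong zero f≈g w = refl
∑-cong (suc n) f≈g w = cong₂ _+_ (f≈g 0 (s≤s ℕ.z≤n) w) (∑-cong n (λ j j<n → f≈g (suc j) (s≤s j<n)) w)

∑-last : ∀ n f → ∑ (suc n) f ≈ ∑ n f ⊕ f n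
∑-last zero f w = +-comm (f 0 w) 0ℚ
∑-last (suc n) f w =
  trans (cong (_+_ (f 0 w)) (∑-last n (λ j → f (suc j)) w)) (sym (+-assoc (f 0 w) _ _))

⧢-distribˡ-∑ : ∀ F n f → F ⧢ ∑ n f ≈ ∑ n (λ j → F ⧢ f j)
⧢-distribˡ-∑ F zero f = ⧢-zeroʳ F
⧢-distribˡ-∑ F (suc n) f w =
  trans (⧢-distribˡ-⊕ F (f 0) (∑ n (λ j → f (suc j))) w)
    (cong (_+_ ((F ⧢ f 0) w)) (⧢-distribˡ-∑ F n (λ j → f (suc j)) w))

infix 4 _≈ₜ_

_≈ₜ_ : TSeries → TSeries → Set
P ≈ₜ Q = ∀ n → P n ≈ Q n

≈ₜ-refl : ∀ {P} → P ≈ₜ P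
≈ₜ-refl n w = refl

≈ₜ-trans : ∀ {P Q R} → P ≈ₜ Q → Q ≈ₜ R → P ≈ₜ R
≈ₜ-trans P≈Q Q≈R n w = trans (P≈Q n w) (Q≈R n w)

⧢ₜ-cong : ∀ {P P′ Q Q′} → P ≈ₜ P′ → Q ≈ₜ Q′ → P ⧢ₜ Q ≈ₜ P′ ⧢ₜ Q′
⧢ₜ-cong {P} {P′} {Q} {Q′} P≈P′ Q≈Q′ n w =
  trans (⧢ₜ-coeff P Q n w)
    (trans (∑-cong (suc n) (λ j _ → ⧢-cong (P≈P′ j) (Q≈Q′ (n ∸ j))) w) (sym (⧢ₜ-coeff P′ Q′ n w)))

^⧢-cong : ∀ {P P′} → P ≈ₜ P′ → ∀ k → P ^⧢ k ≈ₜ P′ ^⧢ k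
^⧢-cong P≈P′ zero = ≈ₜ-refl
^⧢-cong P≈P′ (suc k) = ⧢ₜ-cong P≈P′ (^⧢-cong P≈P′ k)

shift : TSeries → TSeries
shift P zero = zeroS
shift P (suc n) = P n

shift-cong : ∀ {P P′} → P ≈ₜ P′ → shift P ≈ₜ shift P′
shift-cong P≈P′ zero w = refl
shift-cong P≈P′ (suc n) = P≈P′ n

shift-⧢ₜ : ∀ P Q → shift P ⧢ₜ Q ≈ₜ shift (P ⧢ₜ Q)
shift-⧢ₜ P Q zero w = trans (⧢ₜ-coeff (shift P) Q 0 w) (trans (+-identityʳ _) (⧢-zeroˡ (Q 0) w))
shift-⧢ₜ P Q (suc n) w =
  trans (⧢ₜ-coeff (shift P) Q (suc n) w)
    (trans (cong (_+ ∑ (suc n) (λ j → P j ⧢ Q (n ∸ j)) w) (⧢-zeroˡ (Q (suc n)) w))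
      (trans (+-identityˡ _) (sym (⧢ₜ-coeff P Q n w))))

⧢ₜ-shift : ∀ P Q → P ⧢ₜ shift Q ≈ₜ shift (P ⧢ₜ Q)
⧢ₜ-shift P Q zero w = trans (⧢ₜ-coeff P (shift Q) 0 w) (trans (+-identityʳ _) (⧢-zeroʳ (P 0) w))
⧢ₜ-shift P Q (suc n) w = begin
  (P ⧢ₜ shift Q) (suc n) w                 ≡⟨ ⧢ₜ-coeff P (shift Q) (suc n) w ⟩
  ∑ (suc (suc n)) f w                      ≡⟨ ∑-last (suc n) f w ⟩
  ∑ (suc n) f w + f (suc n) w              ≡⟨ cong (_+_ (∑ (suc n) f w)) last-vanishes ⟩
  ∑ (suc n) f w + 0ℚ                       ≡⟨ +-identityʳ _ ⟩
  ∑ (suc n) f w                            ≡⟨ ∑-cong (suc n) shifted-index w ⟩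
  ∑ (suc n) (λ j → P j ⧢ Q (n ∸ j)) w      ≡⟨ ⧢ₜ-coeff P Q n w ⟨
  (P ⧢ₜ Q) n w                             ∎
  where
  open ≡-Reasoning
  f : ℕ → Series
  f j = P j ⧢ shift Q (suc n ∸ j)
  last-vanishes : f (suc n) w ≡ 0ℚ
  last-vanishes = trans (cong (λ m → (P (suc n) ⧢ shift Q m) w) (n∸n≡0 n)) (⧢-zeroʳ (P (suc n)) w)
  shifted-index : ∀ j → j ℕ.< suc n → f j ≈ P j ⧢ Q (n ∸ j)
  shifted-index j (s≤s j≤n) v = cong (λ m → (P j ⧢ shift Q m) v) (+-∸-assoc 1 j≤n)

shift^ : ℕ → TSeries → TSeries
shift^ zero P = P
shift^ (suc k) P = shift (shift^ k P)

shift^-cong : ∀ k {P P′} → P ≈ₜ P′ → shift^ k P ≈ₜ shift^ k P′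
shift^-cong zero P≈P′ = P≈P′
shift^-cong (suc k) P≈P′ = shift-cong (shift^-cong k P≈P′)

⧢ₜ-shift^ : ∀ k P Q → P ⧢ₜ shift^ k Q ≈ₜ shift^ k (P ⧢ₜ Q)
⧢ₜ-shift^ zero P Q = ≈ₜ-refl
⧢ₜ-shift^ (suc k) P Q = ≈ₜ-trans (⧢ₜ-shift P (shift^ k Q)) (shift-cong (⧢ₜ-shift^ k P Q))

shift-^⧢ : ∀ k P → shift P ^⧢ k ≈ₜ shift^ k (P ^⧢ k)
shift-^⧢ zero P = ≈ₜ-refl
shift-^⧢ (suc k) P =
  ≈ₜ-trans (⧢ₜ-cong {shift P} ≈ₜ-refl (shift-^⧢ k P))
    (≈ₜ-trans (shift-⧢ₜ P (shift^ k (P ^⧢ k))) (shift-cong (⧢ₜ-shift^ k P (P ^⧢ k))))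

coeffℤ : TSeries → ℤ → Series
coeffℤ P (+ n) = P n
coeffℤ P -[1+ _ ] = zeroS

shift^-coeff : ∀ k P n → shift^ k P n ≈ coeffℤ P (+ n - + k)
shift^-coeff zero P n w = cong (λ m → P m w) (sym (ℕ.+-identityʳ n))
shift^-coeff (suc k) P zero = λ _ → refl
shift^-coeff (suc k) P (suc n) rewrite ℤ.m-n≡m⊖n (suc n) (suc k) | ℤ.[1+m]⊖[1+n]≡m⊖n n k | sym (ℤ.m-n≡m⊖n n k) =
  shift^-coeff k P n

infixr 7 _·_

_·_ : Series → TSeries → TSeries
(F · P) n = F ⧢ P n

coeffℤ-· : ∀ F P z → coeffℤ (F · P) z ≈ F ⧢ coeffℤ P z
coeffℤ-· F P (+ n) w = refl
coeffℤ-· F P -[1+ _ ] w = sym (⧢-zeroʳ F w)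

·-⧢ₜ-· : ∀ F P G Q → (F · P) ⧢ₜ (G · Q) ≈ₜ (F ⧢ G) · (P ⧢ₜ Q)
·-⧢ₜ-· F P G Q n w =
  trans (⧢ₜ-coeff (F · P) (G · Q) n w)
    (trans (∑-cong (suc n) (λ j _ → ⧢-interchange F (P j) G (Q (n ∸ j))) w)
      (trans (sym (⧢-distribˡ-∑ (F ⧢ G) (suc n) (λ j → P j ⧢ Q (n ∸ j)) w))
        (⧢-congˡ (F ⧢ G) (λ v → sym (⧢ₜ-coeff P Q n v)) w)))

_⧢^_ : Series → ℕ → Series
F ⧢^ zero = oneS
F ⧢^ suc k = F ⧢ (F ⧢^ k)

⧢^-cong : ∀ {F G} → F ≈ G → ∀ k → F ⧢^ k ≈ G ⧢^ k
⧢^-cong F≈G zero w = refl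
⧢^-cong F≈G (suc k) = ⧢-cong F≈G (⧢^-cong F≈G k)

·-^⧢ : ∀ k F P → (F · P) ^⧢ k ≈ₜ (F ⧢^ k) · (P ^⧢ k)
·-^⧢ zero F P n w = sym (⧢-identityˡ (oneT n) w)
·-^⧢ (suc k) F P = ≈ₜ-trans (⧢ₜ-cong {F · P} ≈ₜ-refl (·-^⧢ k F P)) (·-⧢ₜ-· F P (F ⧢^ k) (P ^⧢ k))

words : Subalphabet → ℕ → Series
words B m w = indicator ((length w ≡ᵇ m) ∧ all B w)

words-zero : ∀ B → words B 0 ≈ oneS
words-zero B [] = refl
words-zero B (x ∷ w) = refl

∂-words-zero : ∀ x B → ∂ x (words B 0) ≈ zeroS
∂-words-zero x B w = refl

∂-words-suc : ∀ x B m → ∂ x (words B (suc m)) ≈ scale (indicator (B x)) (words B m)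
∂-words-suc x B m w = indicator-∧ (length w ≡ᵇ m) (B x) (all B w)
  where
  indicator-∧ : ∀ l b r → indicator (l ∧ (b ∧ r)) ≡ indicator b * indicator (l ∧ r)
  indicator-∧ l true r = sym (*-identityˡ (indicator (l ∧ r)))
  indicator-∧ true false r = sym (*-zeroˡ (indicator r))
  indicator-∧ false false r = sym (*-zeroˡ 0ℚ)

words-1-⧢-words : ∀ B m → words B 1 ⧢ words B m ≈ scale (fromℕ (suc m)) (words B (suc m))
words-1-⧢-words B m [] =
  trans (⧢-[] (words B 1) (words B m)) (trans (*-zeroˡ (words B m [])) (sym (*-zeroʳ (fromℕ (suc m)))))
words-1-⧢-words B m (x ∷ w) = begin
  (words B 1 ⧢ words B m) (x ∷ w)                              ≡⟨ ⧢-∂ x (words B 1) (words B m) w ⟩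
  (∂ x (words B 1) ⧢ words B m) w + (words B 1 ⧢ ∂ x (words B m)) w
                                                               ≡⟨ cong₂ _+_ x-first (x-later m) ⟩
  b * words B m w + fromℕ m * (b * words B m w)               ≡⟨ collect b (words B m w) (fromℕ m) ⟩
  (1ℚ + fromℕ m) * (b * words B m w)                          ≡⟨ cong₂ _*_ (sym (fromℕ-+ 1 m)) (sym (∂-words-suc x B m w)) ⟩
  fromℕ (suc m) * words B (suc m) (x ∷ w)                      ∎
  where
  open ≡-Reasoning
  b : ℚ
  b = indicator (B x)
  collect : ∀ b d i → b * d + i * (b * d) ≡ (1ℚ + i) * (b * d)
  collect = solve 3 (λ b d i → b :* d :+ i :* (b :* d) := (con 1ℚ :+ i) :* (b :* d)) refl
    where open +-*-Solver
  x-first : (∂ x (words B 1) ⧢ words B m) w ≡ b * words B m w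
  x-first =
    trans (⧢-congʳ (words B m) (∂-words-suc x B 0) w)
      (trans (⧢-scaleˡ b (words B 0) (words B m) w)
        (cong (b *_) (trans (⧢-congʳ (words B m) (words-zero B) w) (⧢-identityˡ (words B m) w))))
  x-later : ∀ m → (words B 1 ⧢ ∂ x (words B m)) w ≡ fromℕ m * (b * words B m w)
  x-later zero =
    trans (⧢-congˡ (words B 1) (∂-words-zero x B) w)
      (trans (⧢-zeroʳ (words B 1) w) (sym (*-zeroˡ (b * words B 0 w))))
  x-later (suc m) =
    trans (⧢-congˡ (words B 1) (∂-words-suc x B m) w)
      (trans (⧢-scaleʳ b (words B 1) (words B m) w)
        (trans (cong (b *_) (words-1-⧢-words B m w))
          (x*yz≡y*xz b (fromℕ (suc m)) (words B (suc m) w))))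

words-1-⧢^ : ∀ B k → words B 1 ⧢^ k ≈ scale (fromℕ (k !)) (words B k)
words-1-⧢^ B zero w = trans (sym (words-zero B w)) (sym (*-identityˡ (words B 0 w)))
words-1-⧢^ B (suc k) w = begin
  (words B 1 ⧢ (words B 1 ⧢^ k)) w                             ≡⟨ ⧢-congˡ (words B 1) (words-1-⧢^ B k) w ⟩
  (words B 1 ⧢ scale (fromℕ (k !)) (words B k)) w               ≡⟨ ⧢-scaleʳ (fromℕ (k !)) (words B 1) (words B k) w ⟩
  fromℕ (k !) * (words B 1 ⧢ words B k) w                      ≡⟨ cong (fromℕ (k !) *_) (words-1-⧢-words B k w) ⟩
  fromℕ (k !) * (fromℕ (suc k) * words B (suc k) w)            ≡⟨ *-assoc (fromℕ (k !)) (fromℕ (suc k)) _ ⟨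
  (fromℕ (k !) * fromℕ (suc k)) * words B (suc k) w            ≡⟨ cong (_* words B (suc k) w) (*-comm (fromℕ (k !)) (fromℕ (suc k))) ⟩
  (fromℕ (suc k) * fromℕ (k !)) * words B (suc k) w            ≡⟨ cong (_* words B (suc k) w) (fromℕ-* (suc k) (k !)) ⟨
  fromℕ (suc k !) * words B (suc k) w                          ∎
  where open ≡-Reasoning

singletons : List ℕ → Partition
singletons = map (_∷ [])

refinements-singletons : ∀ L → refinements (singletons L) ≡ singletons L ∷ []
refinements-singletons [] = refl
refinements-singletons (i ∷ L) rewrite refinements-singletons L = refl

Ψ-singletons : ∀ L B → Ψ (singletons L) B ≈ words B (length L)
Ψ-singletons L B w = begin
  (+ factorials L / 1) * Φ (singletons L) B w
    ≡⟨ cong (λ n → (+ n / 1) * Φ (singletons L) B w) (factorials-singletons L) ⟩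
  1ℚ * Φ (singletons L) B w
    ≡⟨ *-identityˡ _ ⟩
  indicator ((length w ≡ᵇ size (singletons L)) ∧ all B w ∧ and (map (blockConst w) (singletons L)))
    ≡⟨ cong₂ (λ s c → indicator ((length w ≡ᵇ s) ∧ all B w ∧ c)) (size-singletons L) (blockConst-singletons L) ⟩
  indicator ((length w ≡ᵇ length L) ∧ all B w ∧ true)
    ≡⟨ cong (λ c → indicator ((length w ≡ᵇ length L) ∧ c)) (∧-identityʳ (all B w)) ⟩
  words B (length L) w ∎
  where
  open ≡-Reasoning
  factorials : List ℕ → ℕ
  factorials L = foldr (λ b n → (length b !) ℕ.* n) 1 (singletons L)
  factorials-singletons : ∀ L → factorials L ≡ 1
  factorials-singletons [] = refl
  factorials-singletons (i ∷ L) rewrite factorials-singletons L = refl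
  size-singletons : ∀ L → size (singletons L) ≡ length L
  size-singletons [] = refl
  size-singletons (i ∷ L) = cong suc (size-singletons L)
  blockConst-singletons : ∀ L → and (map (blockConst w) (singletons L)) ≡ true
  blockConst-singletons [] = refl
  blockConst-singletons (i ∷ L) = blockConst-singletons L

S-finest : ∀ k B → S (finest k) B ≈ words B k
S-finest k B w = begin
  S (finest k) B w                   ≡⟨ cong (λ πs → sumS (map (λ π′ → Ψ π′ B) πs) w) (refinements-singletons L) ⟩
  Ψ (singletons L) B w + 0ℚ           ≡⟨ +-identityʳ _ ⟩
  Ψ (singletons L) B w               ≡⟨ Ψ-singletons L B w ⟩
  words B (length L) w               ≡⟨ cong (λ n → words B n w) (trans (length-map suc (upTo k)) (length-upTo k)) ⟩
  words B k w                        ∎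
  where
  open ≡-Reasoning
  L : List ℕ
  L = map suc (upTo k)

1/k!-words-1-⧢^ : ∀ B k → scale ((+ 1 / k !) {{k !≢0}}) (words B 1 ⧢^ k) ≈ words B k
1/k!-words-1-⧢^ B k w = begin
  c * (words B 1 ⧢^ k) w                   ≡⟨ cong (c *_) (words-1-⧢^ B k w) ⟩
  c * (fromℕ (k !) * words B k w)          ≡⟨ *-assoc c (fromℕ (k !)) (words B k w) ⟨
  (c * fromℕ (k !)) * words B k w          ≡⟨ cong (_* words B k w) (1/n*n≡1 (k !) {{k !≢0}}) ⟩
  1ℚ * words B k w                         ≡⟨ *-identityˡ (words B k w) ⟩
  words B k w                              ∎
  where
  open ≡-Reasoning
  c : ℚ
  c = (+ 1 / k !) {{k !≢0}}

Bell-shift : ∀ n k F P → (∀ i → F (suc i) ≈ P i) →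
  Bell n k F ≈ scale ((+ 1 / k !) {{k !≢0}}) (shift^ k (P ^⧢ k) n)
Bell-shift n k F P F≈P w =
  cong (((+ 1 / k !) {{k !≢0}}) *_) (≈ₜ-trans (^⧢-cong (λ { zero _ → refl ; (suc i) → F≈P i }) k) (shift-^⧢ k P) n w)

SOneMul-coeffℤ : ∀ k z B → SOneMul k z B ≈ coeffℤ ((λ m → SOne (+ m) B) ^⧢ k) z
SOneMul-coeffℤ k (+ n) B w = refl
SOneMul-coeffℤ k -[1+ _ ] B w = refl

mainTheorem11 : (A′ A″ : Subalphabet) → (∀ a → A′ a ∧ A″ a ≡ false) →
    (n k : ℕ) → ∀ w →
    Bell n k (SSup A′ A″) w ≡ (S (finest k) A′ ⧢ SOneMul k (+ n - + k) A″) w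
mainTheorem11 A′ A″ _ n k = begin
  Bell n k (SSup A′ A″)                          ≈⟨ Bell-shift n k (SSup A′ A″) (a · G) (λ i _ → refl) ⟩
  scale c (shift^ k ((a · G) ^⧢ k) n)            ≈⟨ scale-cong (shift^-cong k (·-^⧢ k a G) n) ⟩
  scale c (shift^ k ((a ⧢^ k) · (G ^⧢ k)) n)     ≈⟨ scale-cong (shift^-coeff k ((a ⧢^ k) · (G ^⧢ k)) n) ⟩
  scale c (coeffℤ ((a ⧢^ k) · (G ^⧢ k)) z)        ≈⟨ scale-cong (coeffℤ-· (a ⧢^ k) (G ^⧢ k) z) ⟩
  scale c ((a ⧢^ k) ⧢ coeffℤ (G ^⧢ k) z)          ≈⟨ ⧢-scaleˡ c (a ⧢^ k) (coeffℤ (G ^⧢ k) z) ⟨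
  scale c (a ⧢^ k) ⧢ coeffℤ (G ^⧢ k) z            ≈⟨ ⧢-cong a^k/k!≈S (λ v → sym (SOneMul-coeffℤ k z A″ v)) ⟩
  S (finest k) A′ ⧢ SOneMul k z A″               ∎
  where
  open SetoidReasoning ≈-setoid
  a : Series
  a = SOne (+ 1) A′
  G : TSeries
  G m = SOne (+ m) A″
  z : ℤ
  z = + n - + k
  c : ℚ
  c = (+ 1 / k !) {{k !≢0}}
  scale-cong : ∀ {F F′} → F ≈ F′ → scale c F ≈ scale c F′
  scale-cong F≈F′ w = cong (c *_) (F≈F′ w)
  a^k/k!≈S : scale c (a ⧢^ k) ≈ S (finest k) A′
  a^k/k!≈S w =
    trans (cong (c *_) (⧢^-cong (S-finest 1 A′) k w))
      (trans (1/k!-words-1-⧢^ A′ k w) (sym (S-finest k A′ w)))
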